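{- Let $l,s$ be positive integers and $P=\{1,\dots,ls+1\}$. For each $i\in P$ let $\{B_{i1},\dots,B_{is}\}$ be a partition of $P\setminus\{i\}$ into $s$ blocks, each of size $l$. Let $D_2$ be the directed graph with vertex set $V=\{(i,B_{ig}): 1\le i\le ls+1,\ 1\le g\le s\}$ and an arc $(i,B_{ig})\to(j,B_{jh})$ if and only if either $i\in B_{jh}$, or $i=j$ and $B_{ig}\neq B_{jh}$. Then $D_2$ is a directed strongly regular graph with parameters \[(v,k,t,\lambda,\mu)=\big(ls^2+s,\ ls+s-1,\ l+s-1,\ l+s-2,\ l+1\big).\]
   Context: A directed strongly regular graph with parameters $(v,k,t,\lambda,\mu)$ is a loopless directed graph on $v$ vertices with adjacency matrix $A$ satisfying $AJ=JA=kJ$ and $A^2=tI+\lambda A+\mu(J-I-A)$, where $I$ is the identity and $J$ the all-ones matrix. -}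

module Defs where

open import Data.Nat using (ℕ; zero; suc; _+_; _*_; _∸_)
open import Data.Fin using (Fin; zero; suc; remQuot)
open import Data.Fin.Properties using (_≟_)
open import Data.Bool using (Bool; true; false; _∧_; _∨_; not; if_then_else_)
open import Data.Product using (_×_; _,_)
open import Relation.Nullary.Decidable using (⌊_⌋)
open import Relation.Binary.PropositionalEquality using (_≡_)

Σ : (n : ℕ) → (Fin n → ℕ) → ℕ
Σ zero    f = 0
Σ (suc n) f = f zero + Σ n (λ i → f (suc i))

𝟙 : Bool → ℕ
𝟙 true  = 1
𝟙 false = 0

δ : {n : ℕ} → Fin n → Fin n → ℕ
δ x y = 𝟙 ⌊ x ≟ y ⌋

-- Directed strongly regular graph with parameters (v,k,t,λ,μ):
--   loopless, v vertices, AJ = kJ, JA = kJ, A² = tI + λA + μ(J - I - A)  (entrywise).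
record IsDSRG {n : ℕ} (E : Fin n → Fin n → Bool) (v k t lam mu : ℕ) : Set where
  A : Fin n → Fin n → ℕ
  A x y = 𝟙 (E x y)
  field
    order     : n ≡ v
    loopless  : ∀ x → E x x ≡ false
    AJ≡kJ     : ∀ x → Σ n (λ z → A x z) ≡ k
    JA≡kJ     : ∀ y → Σ n (λ z → A z y) ≡ k
    A²≡       : ∀ x y → Σ n (λ z → A x z * A z y)
                  ≡ t * δ x y + lam * A x y + mu * (1 ∸ (δ x y + A x y))

count : (n : ℕ) → (Fin n → Bool) → ℕ
count n p = Σ n (λ j → 𝟙 (p j))

-- c i j = index g of the block B_{ig} containing j (for j ≠ i; c i i is irrelevant).
-- Hypothesis: for each i, the blocks B_{i g} = { j ≠ i | c i j = g } all have size l.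
IsBlockSystem : (l s : ℕ) → (Fin (l * s + 1) → Fin (l * s + 1) → Fin s) → Set
IsBlockSystem l s c =
  ∀ i g → count (l * s + 1) (λ j → not ⌊ j ≟ i ⌋ ∧ ⌊ c i j ≟ g ⌋) ≡ l

D₂arc : (l s : ℕ) → (Fin (l * s + 1) → Fin (l * s + 1) → Fin s) →
        Fin (l * s + 1) × Fin s → Fin (l * s + 1) × Fin s → Bool
D₂arc l s c (i , g) (j , h) =
  (not ⌊ i ≟ j ⌋ ∧ ⌊ c j i ≟ h ⌋) ∨ (⌊ i ≟ j ⌋ ∧ not ⌊ g ≟ h ⌋)

D₂ : (l s : ℕ) → (Fin (l * s + 1) → Fin (l * s + 1) → Fin s) →
     Fin ((l * s + 1) * s) → Fin ((l * s + 1) * s) → Bool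
D₂ l s c x y = D₂arc l s c (remQuot s x) (remQuot s y)

-- Write [P] for the 0/1 indicator of P.  On the vertex pairs (i , g) the arc
-- indicator of D₂ is the arithmetic expression
--     A((i,g),(j,h)) = [i ≠ j]·[c j i = h] + [i = j]·[g ≠ h],
-- so all three matrix identities are finite double sums that can be evaluated
-- with a small calculus of indicator sums: pulling out constants, picking out
-- the term selected by an [a = z] factor, and splitting one term off a sum.  For A², classify the walks
-- (i,g) → (m,f) → (j,h) by whether m ≠ i (then f = c m i is forced) or m = i;
-- the two resulting counts are expressed through the size l of the block
-- B_{jh} and the number s - 1 of blocks other than B_{jh}, after which the
-- identity is a case analysis on [i = j], [g = h], [c j i = h].

module Submission where

open import Defs
open import Data.Nat using (ℕ; zero; suc; _+_; _*_; _∸_; _<_; s≤s; z≤n)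
open import Data.Nat.Properties
  using (+-comm; +-assoc; +-identityʳ; *-identityʳ; *-zeroʳ; *-comm; *-distribˡ-+;
         *-distribʳ-+; +-∸-assoc; suc-injective)
open import Data.Nat.Tactic.RingSolver using (solve-∀; solve)
open import Data.Fin using (Fin; zero; suc; remQuot; combine; _↑ˡ_; _↑ʳ_)
open import Data.Fin.Properties using (_≟_; remQuot-combine; combine-remQuot)
import Data.Fin.Properties as Fin
open import Data.Bool using (Bool; true; false; _∧_; _∨_; not)
open import Data.Product using (_×_; _,_; proj₁; proj₂; uncurry)
open import Data.Product.Properties using (×-≡,≡→≡)
open import Data.List.Base using (_∷_; [])
open import Data.Empty using (⊥-elim)
open import Relation.Nullary using (yes; no)
open import Relation.Nullary.Decidable using (⌊_⌋)
open import Relation.Binary.PropositionalEquality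
  using (_≡_; refl; sym; trans; cong; cong₂; ≡-≟-identity; module ≡-Reasoning)

𝟙≡ : {k : ℕ} → Fin k → Fin k → ℕ
𝟙≡ a b = 𝟙 ⌊ a ≟ b ⌋

𝟙≢ : {k : ℕ} → Fin k → Fin k → ℕ
𝟙≢ a b = 𝟙 (not ⌊ a ≟ b ⌋)

⌊≟⌋-refl : {k : ℕ} (a : Fin k) → ⌊ a ≟ a ⌋ ≡ true
⌊≟⌋-refl a = cong ⌊_⌋ (≡-≟-identity _≟_ refl)

⌊≟⌋-sym : {k : ℕ} (a b : Fin k) → ⌊ a ≟ b ⌋ ≡ ⌊ b ≟ a ⌋
⌊≟⌋-sym a b with a ≟ b | b ≟ a
... | yes _   | yes _   = refl
... | yes a≡b | no  b≢a = ⊥-elim (b≢a (sym a≡b))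
... | no  a≢b | yes b≡a = ⊥-elim (a≢b (sym b≡a))
... | no  _   | no  _   = refl

⌊≟⌋-suc : {k : ℕ} (a b : Fin k) → ⌊ _≟_ {suc k} (suc a) (suc b) ⌋ ≡ ⌊ a ≟ b ⌋
⌊≟⌋-suc a b with suc a ≟ suc b | a ≟ b
... | yes _     | yes _   = refl
... | yes sa≡sb | no  a≢b = ⊥-elim (a≢b (Fin.suc-injective sa≡sb))
... | no  sa≢sb | yes a≡b = ⊥-elim (sa≢sb (cong suc a≡b))
... | no  _     | no  _   = refl

𝟙≢-sym : {k : ℕ} (a b : Fin k) → 𝟙≢ a b ≡ 𝟙≢ b a
𝟙≢-sym a b = cong (λ t → 𝟙 (not t)) (⌊≟⌋-sym a b)

𝟙-∧ : ∀ a b → 𝟙 (a ∧ b) ≡ 𝟙 a * 𝟙 b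
𝟙-∧ true  b = sym (+-identityʳ (𝟙 b))
𝟙-∧ false b = refl

-- The indicator of "(¬a ∧ b) ∨ (a ∧ c)"; the two disjuncts are exclusive.
𝟙-cases : ∀ a b c → 𝟙 ((not a ∧ b) ∨ (a ∧ c)) ≡ 𝟙 (not a) * 𝟙 b + 𝟙 a * 𝟙 c
𝟙-cases true  b true  = refl
𝟙-cases true  b false = refl
𝟙-cases false true  c = refl
𝟙-cases false false c = refl

Σ-cong : ∀ k {F G : Fin k → ℕ} → (∀ z → F z ≡ G z) → Σ k F ≡ Σ k G
Σ-cong zero    F≡G = refl
Σ-cong (suc k) F≡G = cong₂ _+_ (F≡G zero) (Σ-cong k (λ z → F≡G (suc z)))

Σ-+ : ∀ k (F G : Fin k → ℕ) → Σ k (λ z → F z + G z) ≡ Σ k F + Σ k G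
Σ-+ zero    F G = refl
Σ-+ (suc k) F G =
  trans (cong (F zero + G zero +_) (Σ-+ k (λ z → F (suc z)) (λ z → G (suc z))))
        (interchange (F zero) (G zero) _ _)
  where
  interchange : ∀ a b c d → a + b + (c + d) ≡ (a + c) + (b + d)
  interchange = solve-∀

Σ-*ˡ : ∀ k a (F : Fin k → ℕ) → Σ k (λ z → a * F z) ≡ a * Σ k F
Σ-*ˡ zero    a F = sym (*-zeroʳ a)
Σ-*ˡ (suc k) a F =
  trans (cong (a * F zero +_) (Σ-*ˡ k a (λ z → F (suc z))))
        (sym (*-distribˡ-+ a (F zero) _))

Σ-linear : ∀ k a b (F G : Fin k → ℕ) →
           Σ k (λ z → a * F z + b * G z) ≡ a * Σ k F + b * Σ k G
Σ-linear k a b F G =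
  trans (Σ-+ k (λ z → a * F z) (λ z → b * G z)) (cong₂ _+_ (Σ-*ˡ k a F) (Σ-*ˡ k b G))

Σ-const : ∀ k a → Σ k (λ _ → a) ≡ k * a
Σ-const zero    a = refl
Σ-const (suc k) a = cong (a +_) (Σ-const k a)

Σ-pick : ∀ k (a : Fin k) (G : Fin k → ℕ) → Σ k (λ z → 𝟙≡ a z * G z) ≡ G a
Σ-pick (suc k) zero    G =
  trans (cong (G zero + 0 +_) (trans (Σ-const k 0) (*-zeroʳ k)))
        (trans (+-identityʳ _) (+-identityʳ _))
Σ-pick (suc k) (suc a) G =
  trans (Σ-cong k (λ z → cong (λ t → 𝟙 t * G (suc z)) (⌊≟⌋-suc a z)))
        (Σ-pick k a (λ z → G (suc z)))

Σ-pick′ : ∀ k (a : Fin k) (G : Fin k → ℕ) → Σ k (λ z → 𝟙≡ z a * G z) ≡ G a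
Σ-pick′ k a G =
  trans (Σ-cong k (λ z → cong (λ t → 𝟙 t * G z) (⌊≟⌋-sym z a))) (Σ-pick k a G)

Σ-split : ∀ k (a : Fin k) (F : Fin k → ℕ) → Σ k F ≡ F a + Σ k (λ z → 𝟙≢ a z * F z)
Σ-split (suc k) zero    F = cong (F zero +_) (Σ-cong k (λ z → sym (+-identityʳ _)))
Σ-split (suc k) (suc a) F =
  trans (cong (F zero +_) (Σ-split k a (λ z → F (suc z))))
    (trans (rearrange (F zero) (F (suc a)) _)
      (cong (λ x → F (suc a) + (F zero + 0 + x))
        (Σ-cong k (λ z → cong (λ t → 𝟙 (not t) * F (suc z)) (sym (⌊≟⌋-suc a z))))))
  where
  rearrange : ∀ a b c → a + (b + c) ≡ b + (a + 0 + c)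
  rearrange = solve-∀

Σ-𝟙≡ : ∀ k (a : Fin k) → Σ k (λ z → 𝟙≡ a z) ≡ 1
Σ-𝟙≡ k a = trans (Σ-cong k (λ z → sym (*-identityʳ _))) (Σ-pick k a (λ _ → 1))

Σ-𝟙≢ : ∀ k (a : Fin k) → suc (Σ k (λ z → 𝟙≢ a z)) ≡ k
Σ-𝟙≢ k a = begin
  suc (Σ k (λ z → 𝟙≢ a z))        ≡⟨ cong suc (Σ-cong k (λ z → sym (*-identityʳ _))) ⟩
  suc (Σ k (λ z → 𝟙≢ a z * 1))    ≡⟨ sym (Σ-split k a (λ _ → 1)) ⟩
  Σ k (λ _ → 1)                    ≡⟨ Σ-const k 1 ⟩
  k * 1                            ≡⟨ *-identityʳ k ⟩
  k                                ∎
  where open ≡-Reasoning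

Σ-↑ : ∀ a b (F : Fin (a + b) → ℕ) →
      Σ (a + b) F ≡ Σ a (λ i → F (i ↑ˡ b)) + Σ b (λ j → F (a ↑ʳ j))
Σ-↑ zero    b F = refl
Σ-↑ (suc a) b F =
  trans (cong (F zero +_) (Σ-↑ a b (λ z → F (suc z)))) (sym (+-assoc (F zero) _ _))

Σ-combine : ∀ m k (F : Fin (m * k) → ℕ) →
            Σ (m * k) F ≡ Σ m (λ i → Σ k (λ j → F (combine i j)))
Σ-combine zero    k F = refl
Σ-combine (suc m) k F =
  trans (Σ-↑ k (m * k) F)
        (cong (Σ k (λ j → F (j ↑ˡ (m * k))) +_) (Σ-combine m k (λ z → F (k ↑ʳ z))))

Σ-remQuot : ∀ m k (F : Fin m × Fin k → ℕ) →
            Σ (m * k) (λ z → F (remQuot k z)) ≡ Σ m (λ i → Σ k (λ j → F (i , j)))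
Σ-remQuot m k F =
  trans (Σ-combine m k (λ z → F (remQuot k z)))
        (Σ-cong m (λ i → Σ-cong k (λ j → cong F (remQuot-combine i j))))

δ-remQuot : ∀ m k (x y : Fin (m * k)) →
  δ x y ≡ 𝟙≡ (proj₁ (remQuot {m} k x)) (proj₁ (remQuot {m} k y))
        * 𝟙≡ (proj₂ (remQuot {m} k x)) (proj₂ (remQuot {m} k y))
δ-remQuot m k x y with x ≟ y
... | yes refl rewrite ⌊≟⌋-refl (proj₁ (remQuot {m} k x))
                     | ⌊≟⌋-refl (proj₂ (remQuot {m} k x)) = refl
... | no x≢y with proj₁ (remQuot {m} k x) ≟ proj₁ (remQuot {m} k y)
                | proj₂ (remQuot {m} k x) ≟ proj₂ (remQuot {m} k y)
...   | yes i≡i′ | yes j≡j′ = ⊥-elim (x≢y (begin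
          x                                  ≡⟨ sym (combine-remQuot {m} k x) ⟩
          uncurry combine (remQuot {m} k x)  ≡⟨ cong (uncurry combine) (×-≡,≡→≡ (i≡i′ , j≡j′)) ⟩
          uncurry combine (remQuot {m} k y)  ≡⟨ combine-remQuot {m} k y ⟩
          y                                  ∎))
  where open ≡-Reasoning
...   | yes _ | no  _ = refl
...   | no  _ | yes _ = refl
...   | no  _ | no  _ = refl

record IsDSRGOnPairs {m k : ℕ} (E : Fin m × Fin k → Fin m × Fin k → Bool)
                     (deg t lam mu : ℕ) : Set where
  A : Fin m × Fin k → Fin m × Fin k → ℕ
  A p q = 𝟙 (E p q)
  δ× : Fin m × Fin k → Fin m × Fin k → ℕ
  δ× (i , g) (j , h) = 𝟙≡ i j * 𝟙≡ g h
  field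
    loopless  : ∀ p → E p p ≡ false
    outDegree : ∀ p → Σ m (λ i → Σ k (λ g → A p (i , g))) ≡ deg
    inDegree  : ∀ q → Σ m (λ i → Σ k (λ g → A (i , g) q)) ≡ deg
    twoWalks  : ∀ p q → Σ m (λ i → Σ k (λ g → A p (i , g) * A (i , g) q))
                  ≡ t * δ× p q + lam * A p q + mu * (1 ∸ (δ× p q + A p q))

dsrg-from-pairs : ∀ {m k v deg t lam mu} (E : Fin m × Fin k → Fin m × Fin k → Bool) →
  IsDSRGOnPairs E deg t lam mu → m * k ≡ v →
  IsDSRG (λ x y → E (remQuot k x) (remQuot k y)) v deg t lam mu
dsrg-from-pairs {m} {k} {t = t} {lam} {mu} E onPairs m*k≡v = record
  { order    = m*k≡v
  ; loopless = λ x → loopless (remQuot k x)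
  ; AJ≡kJ    = λ x → trans (Σ-remQuot m k (A (remQuot k x))) (outDegree (remQuot k x))
  ; JA≡kJ    = λ y → trans (Σ-remQuot m k (λ p → A p (remQuot k y))) (inDegree (remQuot k y))
  ; A²≡      = λ x y →
      trans (Σ-remQuot m k (λ p → A (remQuot k x) p * A p (remQuot k y)))
        (trans (twoWalks (remQuot k x) (remQuot k y))
          (cong (λ d → t * d + lam * A (remQuot k x) (remQuot k y)
                       + mu * (1 ∸ (d + A (remQuot k x) (remQuot k y))))
                (sym (δ-remQuot m k x y))))
  }
  where open IsDSRGOnPairs onPairs

-- For s ≥ 1 the truncated subtraction in the degree is harmless.
+-suc-∸1 : ∀ a b → a + suc b ∸ 1 ≡ a + b
+-suc-∸1 a b = +-∸-assoc a (s≤s z≤n)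

-- The final count of two-step walks, by cases on b₁ = [i = j], b₂ = [g = h],
-- b₃ = [c j i = h].  The hypotheses split the block B_{jh} at i (R = its
-- members other than i) and the s - 1 indices f ≠ h at g (Q = indices
-- different from both g and h).
twoWalk-count : ∀ l′ s′ b₁ b₂ b₃ R Q →
  suc l′ ≡ 𝟙 (not b₁) * 𝟙 b₃ + R → s′ ≡ 𝟙 (not b₂) + Q →
  R + 𝟙 (not b₁) * 𝟙 (not b₃) + (𝟙 (not b₁) * 𝟙 b₃ * s′ + 𝟙 b₁ * Q)
  ≡ (suc l′ + suc s′ ∸ 1) * (𝟙 b₁ * 𝟙 b₂)
    + (suc l′ + suc s′ ∸ 2) * (𝟙 (not b₁) * 𝟙 b₃ + 𝟙 b₁ * 𝟙 (not b₂))
    + (suc l′ + 1) * (1 ∸ (𝟙 b₁ * 𝟙 b₂ + (𝟙 (not b₁) * 𝟙 b₃ + 𝟙 b₁ * 𝟙 (not b₂))))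
twoWalk-count l′ s′ true true b₃ R Q refl refl
  rewrite +-suc-∸1 l′ s′ = solve (l′ ∷ s′ ∷ [])
twoWalk-count l′ .(suc Q) true false b₃ R Q refl refl
  rewrite +-suc-∸1 l′ (suc Q) = solve (l′ ∷ Q ∷ [])
twoWalk-count l′ s′ false b₂ true R Q refl _
  rewrite +-suc-∸1 l′ s′ = solve (l′ ∷ s′ ∷ [])
twoWalk-count l′ s′ false b₂ false R Q refl _
  rewrite +-suc-∸1 l′ s′ = solve (l′ ∷ s′ ∷ [])

module D₂OnPairs (l′ s′ : ℕ)
  (c : Fin (suc l′ * suc s′ + 1) → Fin (suc l′ * suc s′ + 1) → Fin (suc s′))
  (blocks : IsBlockSystem (suc l′) (suc s′) c) where

  l s n : ℕ
  l = suc l′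
  s = suc s′
  n = l * s + 1

  A : Fin n × Fin s → Fin n × Fin s → ℕ
  A p q = 𝟙 (D₂arc l s c p q)

  arc : ∀ i g j h → A (i , g) (j , h) ≡ 𝟙≢ i j * 𝟙≡ (c j i) h + 𝟙≡ i j * 𝟙≢ g h
  arc i g j h = 𝟙-cases ⌊ i ≟ j ⌋ ⌊ c j i ≟ h ⌋ (not ⌊ g ≟ h ⌋)

  blockSize : ∀ j h → Σ n (λ m → 𝟙≢ m j * 𝟙≡ (c j m) h) ≡ l
  blockSize j h =
    trans (Σ-cong n (λ m → sym (𝟙-∧ (not ⌊ m ≟ j ⌋) ⌊ c j m ≟ h ⌋))) (blocks j h)

  othersOf : ∀ g → Σ s (λ f → 𝟙≢ g f) ≡ s′
  othersOf g = suc-injective (Σ-𝟙≢ s g)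

  othersOf′ : ∀ h → Σ s (λ f → 𝟙≢ f h) ≡ s′
  othersOf′ h = trans (Σ-cong s (λ f → 𝟙≢-sym f h)) (othersOf h)

  -- (i,g) → (m,f): for m ≠ i exactly one f works, for m = i the s′ values f ≠ g.
  outDegree : ∀ p → Σ n (λ m → Σ s (λ f → A p (m , f))) ≡ l * s + s ∸ 1
  outDegree (i , g) = begin
      Σ n (λ m → Σ s (λ f → A (i , g) (m , f)))
    ≡⟨ Σ-cong n arcsTo ⟩
      Σ n (λ m → 𝟙≢ i m + 𝟙≡ i m * s′)
    ≡⟨ Σ-+ n (𝟙≢ i) (λ m → 𝟙≡ i m * s′) ⟩
      Σ n (𝟙≢ i) + Σ n (λ m → 𝟙≡ i m * s′)
    ≡⟨ cong₂ _+_ (suc-injective (trans (Σ-𝟙≢ n i) (+-comm (l * s) 1)))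
                 (Σ-pick n i (λ _ → s′)) ⟩
      l * s + s′
    ≡⟨ sym (+-suc-∸1 (l * s) s′) ⟩
      l * s + s ∸ 1 ∎
    where
    open ≡-Reasoning
    arcsTo : ∀ m → Σ s (λ f → A (i , g) (m , f)) ≡ 𝟙≢ i m + 𝟙≡ i m * s′
    arcsTo m = begin
        Σ s (λ f → A (i , g) (m , f))
      ≡⟨ Σ-cong s (arc i g m) ⟩
        Σ s (λ f → 𝟙≢ i m * 𝟙≡ (c m i) f + 𝟙≡ i m * 𝟙≢ g f)
      ≡⟨ Σ-linear s (𝟙≢ i m) (𝟙≡ i m) (𝟙≡ (c m i)) (𝟙≢ g) ⟩
        𝟙≢ i m * Σ s (𝟙≡ (c m i)) + 𝟙≡ i m * Σ s (𝟙≢ g)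
      ≡⟨ cong₂ (λ a b → 𝟙≢ i m * a + 𝟙≡ i m * b) (Σ-𝟙≡ s (c m i)) (othersOf g) ⟩
        𝟙≢ i m * 1 + 𝟙≡ i m * s′
      ≡⟨ cong (_+ 𝟙≡ i m * s′) (*-identityʳ (𝟙≢ i m)) ⟩
        𝟙≢ i m + 𝟙≡ i m * s′ ∎

  -- (m,f) → (j,h): every f works when m ∈ B_{jh}, and the s′ values f ≠ h when m = j.
  inDegree : ∀ q → Σ n (λ m → Σ s (λ f → A (m , f) q)) ≡ l * s + s ∸ 1
  inDegree (j , h) = begin
      Σ n (λ m → Σ s (λ f → A (m , f) (j , h)))
    ≡⟨ Σ-cong n arcsFrom ⟩
      Σ n (λ m → s * (𝟙≢ m j * 𝟙≡ (c j m) h) + 𝟙≡ m j * s′)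
    ≡⟨ Σ-+ n (λ m → s * (𝟙≢ m j * 𝟙≡ (c j m) h)) (λ m → 𝟙≡ m j * s′) ⟩
      Σ n (λ m → s * (𝟙≢ m j * 𝟙≡ (c j m) h)) + Σ n (λ m → 𝟙≡ m j * s′)
    ≡⟨ cong₂ _+_ (trans (Σ-*ˡ n s (λ m → 𝟙≢ m j * 𝟙≡ (c j m) h))
                        (cong (s *_) (blockSize j h)))
                 (Σ-pick′ n j (λ _ → s′)) ⟩
      s * l + s′
    ≡⟨ cong (_+ s′) (*-comm s l) ⟩
      l * s + s′
    ≡⟨ sym (+-suc-∸1 (l * s) s′) ⟩
      l * s + s ∸ 1 ∎
    where
    open ≡-Reasoning
    arcsFrom : ∀ m → Σ s (λ f → A (m , f) (j , h))
                   ≡ s * (𝟙≢ m j * 𝟙≡ (c j m) h) + 𝟙≡ m j * s′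
    arcsFrom m = begin
        Σ s (λ f → A (m , f) (j , h))
      ≡⟨ Σ-cong s (λ f → arc m f j h) ⟩
        Σ s (λ f → 𝟙≢ m j * 𝟙≡ (c j m) h + 𝟙≡ m j * 𝟙≢ f h)
      ≡⟨ Σ-+ s (λ _ → 𝟙≢ m j * 𝟙≡ (c j m) h) (λ f → 𝟙≡ m j * 𝟙≢ f h) ⟩
        Σ s (λ _ → 𝟙≢ m j * 𝟙≡ (c j m) h) + Σ s (λ f → 𝟙≡ m j * 𝟙≢ f h)
      ≡⟨ cong₂ _+_ (Σ-const s (𝟙≢ m j * 𝟙≡ (c j m) h))
                   (trans (Σ-*ˡ s (𝟙≡ m j) (λ f → 𝟙≢ f h)) (cong (𝟙≡ m j *_) (othersOf′ h))) ⟩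
        s * (𝟙≢ m j * 𝟙≡ (c j m) h) + 𝟙≡ m j * s′ ∎

  R : Fin n → Fin n → Fin s → ℕ
  R i j h = Σ n (λ m → 𝟙≢ i m * (𝟙≢ m j * 𝟙≡ (c j m) h))

  Q : Fin s → Fin s → ℕ
  Q g h = Σ s (λ f → 𝟙≢ g f * 𝟙≢ f h)

  blockSplit : ∀ i j h → l ≡ 𝟙≢ i j * 𝟙≡ (c j i) h + R i j h
  blockSplit i j h = trans (sym (blockSize j h)) (Σ-split n i (λ m → 𝟙≢ m j * 𝟙≡ (c j m) h))

  othersSplit : ∀ g h → s′ ≡ 𝟙≢ g h + Q g h
  othersSplit g h = trans (sym (othersOf′ h)) (Σ-split s g (λ f → 𝟙≢ f h))

  -- Classifying walks (i,g) → (m,f) → (j,h) by the first step: if m ≠ i the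
  -- middle vertex is (m , c m i); if m = i it is (i , f) with f ≠ g.
  firstStep : ∀ i g j h →
    Σ n (λ m → Σ s (λ f → A (i , g) (m , f) * A (m , f) (j , h)))
    ≡ Σ n (λ m → 𝟙≢ i m * A (m , c m i) (j , h)) + Σ s (λ f → 𝟙≢ g f * A (i , f) (j , h))
  firstStep i g j h = begin
      Σ n (λ m → Σ s (λ f → A (i , g) (m , f) * A (m , f) (j , h)))
    ≡⟨ Σ-cong n middle ⟩
      Σ n (λ m → 𝟙≢ i m * A (m , c m i) (j , h) + 𝟙≡ i m * G m)
    ≡⟨ Σ-+ n (λ m → 𝟙≢ i m * A (m , c m i) (j , h)) (λ m → 𝟙≡ i m * G m) ⟩
      Σ n (λ m → 𝟙≢ i m * A (m , c m i) (j , h)) + Σ n (λ m → 𝟙≡ i m * G m)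
    ≡⟨ cong (Σ n (λ m → 𝟙≢ i m * A (m , c m i) (j , h)) +_) (Σ-pick n i G) ⟩
      Σ n (λ m → 𝟙≢ i m * A (m , c m i) (j , h)) + G i ∎
    where
    open ≡-Reasoning
    G : Fin n → ℕ
    G m = Σ s (λ f → 𝟙≢ g f * A (m , f) (j , h))
    distrib : ∀ a b c d e → (a * b + c * d) * e ≡ a * (b * e) + c * (d * e)
    distrib = solve-∀
    middle : ∀ m → Σ s (λ f → A (i , g) (m , f) * A (m , f) (j , h))
                 ≡ 𝟙≢ i m * A (m , c m i) (j , h) + 𝟙≡ i m * G m
    middle m = begin
        Σ s (λ f → A (i , g) (m , f) * A (m , f) (j , h))
      ≡⟨ Σ-cong s (λ f → trans (cong (_* A (m , f) (j , h)) (arc i g m f))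
                               (distrib (𝟙≢ i m) (𝟙≡ (c m i) f) (𝟙≡ i m) (𝟙≢ g f)
                                        (A (m , f) (j , h)))) ⟩
        Σ s (λ f → 𝟙≢ i m * (𝟙≡ (c m i) f * A (m , f) (j , h))
                 + 𝟙≡ i m * (𝟙≢ g f * A (m , f) (j , h)))
      ≡⟨ Σ-linear s (𝟙≢ i m) (𝟙≡ i m) (λ f → 𝟙≡ (c m i) f * A (m , f) (j , h))
                                      (λ f → 𝟙≢ g f * A (m , f) (j , h)) ⟩
        𝟙≢ i m * Σ s (λ f → 𝟙≡ (c m i) f * A (m , f) (j , h)) + 𝟙≡ i m * G m
      ≡⟨ cong (λ x → 𝟙≢ i m * x + 𝟙≡ i m * G m) (Σ-pick s (c m i) (λ f → A (m , f) (j , h))) ⟩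
        𝟙≢ i m * A (m , c m i) (j , h) + 𝟙≡ i m * G m ∎

  -- Walks leaving i: through m ∈ B_{jh} \ {i, j}, or through m = j ≠ i when h ≠ c j i.
  viaOtherPoint : ∀ i j h →
    Σ n (λ m → 𝟙≢ i m * A (m , c m i) (j , h)) ≡ R i j h + 𝟙≢ i j * 𝟙≢ (c j i) h
  viaOtherPoint i j h = begin
      Σ n (λ m → 𝟙≢ i m * A (m , c m i) (j , h))
    ≡⟨ Σ-cong n (λ m → trans (cong (𝟙≢ i m *_) (arc m (c m i) j h))
                                 (distrib (𝟙≢ i m) (𝟙≢ m j) (𝟙≡ (c j m) h) (𝟙≡ m j)
                                          (𝟙≢ (c m i) h))) ⟩
      Σ n (λ m → 𝟙≢ i m * (𝟙≢ m j * 𝟙≡ (c j m) h) + 𝟙≡ m j * (𝟙≢ i m * 𝟙≢ (c m i) h))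
    ≡⟨ Σ-+ n (λ m → 𝟙≢ i m * (𝟙≢ m j * 𝟙≡ (c j m) h))
             (λ m → 𝟙≡ m j * (𝟙≢ i m * 𝟙≢ (c m i) h)) ⟩
      R i j h + Σ n (λ m → 𝟙≡ m j * (𝟙≢ i m * 𝟙≢ (c m i) h))
    ≡⟨ cong (R i j h +_) (Σ-pick′ n j (λ m → 𝟙≢ i m * 𝟙≢ (c m i) h)) ⟩
      R i j h + 𝟙≢ i j * 𝟙≢ (c j i) h ∎
    where
    open ≡-Reasoning
    distrib : ∀ a x y z w → a * (x * y + z * w) ≡ a * (x * y) + z * (a * w)
    distrib = solve-∀

  viaSamePoint : ∀ i g j h →
    Σ s (λ f → 𝟙≢ g f * A (i , f) (j , h))
    ≡ 𝟙≢ i j * 𝟙≡ (c j i) h * s′ + 𝟙≡ i j * Q g h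
  viaSamePoint i g j h = begin
      Σ s (λ f → 𝟙≢ g f * A (i , f) (j , h))
    ≡⟨ Σ-cong s (λ f → trans (cong (𝟙≢ g f *_) (arc i f j h))
                               (distrib (𝟙≢ g f) (𝟙≢ f h) (𝟙≢ i j * 𝟙≡ (c j i) h) (𝟙≡ i j))) ⟩
      Σ s (λ f → 𝟙≢ i j * 𝟙≡ (c j i) h * 𝟙≢ g f + 𝟙≡ i j * (𝟙≢ g f * 𝟙≢ f h))
    ≡⟨ Σ-linear s (𝟙≢ i j * 𝟙≡ (c j i) h) (𝟙≡ i j) (𝟙≢ g) (λ f → 𝟙≢ g f * 𝟙≢ f h) ⟩
      𝟙≢ i j * 𝟙≡ (c j i) h * Σ s (𝟙≢ g) + 𝟙≡ i j * Q g h
    ≡⟨ cong (λ x → 𝟙≢ i j * 𝟙≡ (c j i) h * x + 𝟙≡ i j * Q g h) (othersOf g) ⟩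
      𝟙≢ i j * 𝟙≡ (c j i) h * s′ + 𝟙≡ i j * Q g h ∎
    where
    open ≡-Reasoning
    distrib : ∀ a b x y → a * (x + y * b) ≡ x * a + y * (a * b)
    distrib = solve-∀

  twoWalks : ∀ p q → Σ n (λ m → Σ s (λ f → A p (m , f) * A (m , f) q))
    ≡ (l + s ∸ 1) * (𝟙≡ (proj₁ p) (proj₁ q) * 𝟙≡ (proj₂ p) (proj₂ q)) + (l + s ∸ 2) * A p q
      + (l + 1) * (1 ∸ (𝟙≡ (proj₁ p) (proj₁ q) * 𝟙≡ (proj₂ p) (proj₂ q) + A p q))
  twoWalks (i , g) (j , h) = begin
      Σ n (λ m → Σ s (λ f → A (i , g) (m , f) * A (m , f) (j , h)))
    ≡⟨ firstStep i g j h ⟩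
      Σ n (λ m → 𝟙≢ i m * A (m , c m i) (j , h)) + Σ s (λ f → 𝟙≢ g f * A (i , f) (j , h))
    ≡⟨ cong₂ _+_ (viaOtherPoint i j h) (viaSamePoint i g j h) ⟩
      R i j h + 𝟙≢ i j * 𝟙≢ (c j i) h + (𝟙≢ i j * 𝟙≡ (c j i) h * s′ + 𝟙≡ i j * Q g h)
    ≡⟨ twoWalk-count l′ s′ ⌊ i ≟ j ⌋ ⌊ g ≟ h ⌋ ⌊ c j i ≟ h ⌋ (R i j h) (Q g h)
                     (blockSplit i j h) (othersSplit g h) ⟩
      rhs (𝟙≢ i j * 𝟙≡ (c j i) h + 𝟙≡ i j * 𝟙≢ g h)
    ≡⟨ cong rhs (sym (arc i g j h)) ⟩
      rhs (A (i , g) (j , h)) ∎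
    where
    open ≡-Reasoning
    rhs : ℕ → ℕ
    rhs a = (l + s ∸ 1) * (𝟙≡ i j * 𝟙≡ g h) + (l + s ∸ 2) * a
            + (l + 1) * (1 ∸ (𝟙≡ i j * 𝟙≡ g h + a))

  noLoops : ∀ p → D₂arc l s c p p ≡ false
  noLoops (i , g) rewrite ⌊≟⌋-refl i | ⌊≟⌋-refl g = refl

  isDSRGOnPairs : IsDSRGOnPairs (D₂arc l s c) (l * s + s ∸ 1) (l + s ∸ 1) (l + s ∸ 2) (l + 1)
  isDSRGOnPairs = record
    { loopless  = noLoops
    ; outDegree = outDegree
    ; inDegree  = inDegree
    ; twoWalks  = twoWalks
    }

mainTheorem10 : (l s : ℕ) → 0 < l → 0 < s →
    (c : Fin (l * s + 1) → Fin (l * s + 1) → Fin s) → IsBlockSystem l s c →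
    IsDSRG (D₂ l s c) (l * s * s + s) (l * s + s ∸ 1) (l + s ∸ 1) (l + s ∸ 2) (l + 1)
mainTheorem10 l@(suc l′) s@(suc s′) (s≤s z≤n) (s≤s z≤n) c blocks =
  dsrg-from-pairs (D₂arc l s c) (D₂OnPairs.isDSRGOnPairs l′ s′ c blocks) vertexCount
  where
  vertexCount : (l * s + 1) * s ≡ l * s * s + s
  vertexCount = trans (*-distribʳ-+ s (l * s) 1) (cong (l * s * s +_) (+-identityʳ s))
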